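{- Let $p>q\geq 1$ be integers, let $\varphi$ be the substitution $A\mapsto A^pB,\ B\mapsto A^qB$ and $u_\beta$ its fixed point $\lim_n\varphi^n(A)$. Define finite words $w_\beta^{(1)}=B$ and $w_\beta^{(n)}=B\varphi(w_\beta^{(n-1)})$ for $n\ge 2$; each $w_\beta^{(n)}$ is a prefix of $w_\beta^{(n+1)}$, and let $w_\beta=\lim_{n\to\infty}w_\beta^{(n)}$ (so $w_\beta=B\varphi(w_\beta)$). Then any prefix of $w_\beta$ contains at least as many letters $B$ as any factor of $u_\beta$ of the same length.
   Context: $|v|_B$ denotes the number of occurrences of the letter $B$ in a finite word $v$; a factor of $u_\beta$ is a finite contiguous subword. -}

module Defs where

open import Data.Nat using (ℕ; zero; suc; _+_)
open import Data.List using (List; []; _∷_; _++_; replicate; concatMap; take; drop; length)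

data Letter : Set where
  A B : Letter

φ₁ : ℕ → ℕ → Letter → List Letter
φ₁ p q A = replicate p A ++ (B ∷ [])
φ₁ p q B = replicate q A ++ (B ∷ [])

φ : ℕ → ℕ → List Letter → List Letter
φ p q = concatMap (φ₁ p q)

φ^ : ℕ → ℕ → ℕ → List Letter → List Letter
φ^ p q zero    v = v
φ^ p q (suc k) v = φ p q (φ^ p q k v)

countB : List Letter → ℕ
countB []       = 0
countB (A ∷ v) = countB v
countB (B ∷ v) = suc (countB v)

-- w^{(n)} with w^{(0)} := [] so that w^{(1)} = B, w^{(n)} = B φ(w^{(n-1)})
wFin : ℕ → ℕ → ℕ → List Letter
wFin p q zero    = []
wFin p q (suc n) = B ∷ φ p q (wFin p q n)

-- Since |φ^k(A)| ≥ 2^k ≥ k+1 (p ≥ 2,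
-- every letter has image of length ≥ 2) and φ^k(A) is a prefix of φ^{k+1}(A),
-- the first N letters of u_β are the first N letters of φ^N(A).
uPrefix : ℕ → ℕ → ℕ → List Letter
uPrefix p q N = take N (φ^ p q N (A ∷ []))

uFactor : ℕ → ℕ → (i n : ℕ) → List Letter
uFactor p q i n = drop i (uPrefix p q (i + n))

-- prefix of length n of w_β: since |w^{(n)}| ≥ n and w^{(n)} is a prefix of
-- w^{(n+1)}, it is the length-n prefix of w^{(n)}.
wPrefix : ℕ → ℕ → ℕ → List Letter
wPrefix p q n = take n (wFin p q n)

module Submission where

-- A factor v of u_β containing a B desubstitutes: v = A^j B φ(y) A^k with y a shorter
-- factor and |y| + 1 = |v|_B. By induction y has at most as many B's as the prefix z of
-- w_β of length |y|. Since |φ(y)| = (p + 1)|y| − (p − q)|y|_B decreases with |y|_B, we get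
-- |φ(z)| ≤ |φ(y)|, so B φ(z), a prefix of w_β = B φ(w_β), is no longer than v and has
-- exactly |v|_B letters B. Finally, along the prefixes of w_β the number of B's grows.

open import Defs
open import Data.Nat using (ℕ; zero; suc; _+_; _*_; _≤_; _<_; z≤n; s≤s)
open import Data.Nat.Properties
open import Data.Nat.Induction using (<-wellFounded)
open import Data.Nat.Solver using (module +-*-Solver)
open import Data.List using (List; []; _∷_; _++_; replicate; take; drop; length)
open import Data.List.Properties using (length-take)
open import Data.List.Relation.Binary.Pointwise.Properties as Pointwise using ()
open import Data.List.Relation.Binary.Prefix.Heterogeneous using (Prefix; []; _∷_)
open import Data.List.Relation.Binary.Prefix.Heterogeneous.Properties as Prefix using ()
open import Data.List.Relation.Binary.Infix.Heterogeneous using (Infix; here; there)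
open import Data.Product using (_×_; _,_; ∃-syntax)
open import Data.Sum using (_⊎_; inj₁; inj₂; map₂)
open import Induction.WellFounded using (Acc; acc)
open import Relation.Binary.PropositionalEquality

module _ {ℓ} {T : Set ℓ} where

  take-Prefix : ∀ n (xs : List T) → Prefix _≡_ (take n xs) xs
  take-Prefix zero    xs       = []
  take-Prefix (suc n) []       = []
  take-Prefix (suc n) (x ∷ xs) = refl ∷ take-Prefix n xs

  drop-Infix : ∀ i {xs ys : List T} → Prefix _≡_ xs ys → Infix _≡_ (drop i xs) ys
  drop-Infix zero    xs⊑ys        = here xs⊑ys
  drop-Infix (suc i) []           = here []
  drop-Infix (suc i) (_ ∷ xs⊑ys) = there (drop-Infix i xs⊑ys)

  Prefix-by-length : ∀ {xs ys zs : List T} → Prefix _≡_ xs zs → Prefix _≡_ ys zs →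
                     length xs ≤ length ys → Prefix _≡_ xs ys
  Prefix-by-length []              _               _         = []
  Prefix-by-length (refl ∷ xs⊑zs) (refl ∷ ys⊑zs) (s≤s len) = refl ∷ Prefix-by-length xs⊑zs ys⊑zs len

  length-drop-take≤ : ∀ i n (xs : List T) → length (drop i (take (i + n) xs)) ≤ n
  length-drop-take≤ zero    n xs       = ≤-trans (≤-reflexive (length-take n xs)) (m⊓n≤m n _)
  length-drop-take≤ (suc i) n []       = z≤n
  length-drop-take≤ (suc i) n (x ∷ xs) = length-drop-take≤ i n xs

countB≤length : ∀ v → countB v ≤ length v
countB≤length []      = z≤n
countB≤length (A ∷ v) = m≤n⇒m≤1+n (countB≤length v)
countB≤length (B ∷ v) = s≤s (countB≤length v)

countB-Prefix-mono : ∀ {u v} → Prefix _≡_ u v → countB u ≤ countB v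
countB-Prefix-mono []                    = z≤n
countB-Prefix-mono {A ∷ _} (refl ∷ u⊑v) = countB-Prefix-mono u⊑v
countB-Prefix-mono {B ∷ _} (refl ∷ u⊑v) = s≤s (countB-Prefix-mono u⊑v)

countB-Infix-mono : ∀ {u v} → Infix _≡_ u v → countB u ≤ countB v
countB-Infix-mono (here u⊑v)              = countB-Prefix-mono u⊑v
countB-Infix-mono {v = A ∷ _} (there u⊑v) = countB-Infix-mono u⊑v
countB-Infix-mono {v = B ∷ _} (there u⊑v) = m≤n⇒m≤1+n (countB-Infix-mono u⊑v)

block : ℕ → List Letter
block r = replicate r A ++ B ∷ []

countB-block++ : ∀ r Z → countB (block r ++ Z) ≡ suc (countB Z)
countB-block++ zero    Z = refl
countB-block++ (suc r) Z = countB-block++ r Z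

length-block++ : ∀ r Z → length (block r ++ Z) ≡ suc (r + length Z)
length-block++ zero    Z = refl
length-block++ (suc r) Z = cong suc (length-block++ r Z)

prefix-of-block++ : ∀ r {v Z} → Prefix _≡_ v (block r ++ Z) →
                    countB v ≡ 0 ⊎ ∃[ v′ ] v ≡ block r ++ v′ × Prefix _≡_ v′ Z
prefix-of-block++ zero    []              = inj₁ refl
prefix-of-block++ zero    (refl ∷ v′⊑Z) = inj₂ (_ , refl , v′⊑Z)
prefix-of-block++ (suc r) []              = inj₁ refl
prefix-of-block++ (suc r) (refl ∷ v⊑)   =
  map₂ (λ (v′ , v≡ , v′⊑Z) → v′ , cong (A ∷_) v≡ , v′⊑Z) (prefix-of-block++ r v⊑)

infix-of-block++ : ∀ r {v Z} → Infix _≡_ v (block r ++ Z) →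
                   Infix _≡_ v Z ⊎ ∃[ j ] Prefix _≡_ v (block j ++ Z)
infix-of-block++ zero    (here v⊑)    = inj₂ (zero , v⊑)
infix-of-block++ zero    (there v⊑Z) = inj₁ v⊑Z
infix-of-block++ (suc r) (here v⊑)    = inj₂ (suc r , v⊑)
infix-of-block++ (suc r) (there v⊑)  = infix-of-block++ r v⊑

module _ (p q : ℕ) where

  exponent : Letter → ℕ
  exponent A = p
  exponent B = q

  φ-∷ : ∀ x X → φ p q (x ∷ X) ≡ block (exponent x) ++ φ p q X
  φ-∷ A X = refl
  φ-∷ B X = refl

  length-φ-∷ : ∀ x X → length (φ p q (x ∷ X)) ≡ suc (exponent x + length (φ p q X))
  length-φ-∷ x X = trans (cong length (φ-∷ x X)) (length-block++ (exponent x) (φ p q X))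

  countB-φ : ∀ y → countB (φ p q y) ≡ length y
  countB-φ []      = refl
  countB-φ (x ∷ y) = begin
    countB (φ p q (x ∷ y))                  ≡⟨ cong countB (φ-∷ x y) ⟩
    countB (block (exponent x) ++ φ p q y)  ≡⟨ countB-block++ (exponent x) (φ p q y) ⟩
    suc (countB (φ p q y))                  ≡⟨ cong suc (countB-φ y) ⟩
    suc (length y)                          ∎
    where open ≡-Reasoning

  length≤length-φ : ∀ y → length y ≤ length (φ p q y)
  length≤length-φ []      = z≤n
  length≤length-φ (x ∷ y) = begin
    suc (length y)                          ≤⟨ s≤s (≤-trans (length≤length-φ y) (m≤n+m _ (exponent x))) ⟩
    suc (exponent x + length (φ p q y))     ≡⟨ length-φ-∷ x y ⟨
    length (φ p q (x ∷ y))                  ∎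
    where open ≤-Reasoning

  φ-Prefix : ∀ {x y} → Prefix _≡_ x y → Prefix _≡_ (φ p q x) (φ p q y)
  φ-Prefix []            = []
  φ-Prefix (refl ∷ x⊑y) = Prefix.++⁺ (Pointwise.refl refl) (φ-Prefix x⊑y)

  prefix-desubstitution : ∀ X {v} → Prefix _≡_ v (φ p q X) →
    ∃[ y ] Prefix _≡_ y X × length y ≡ countB v × length (φ p q y) ≤ length v
  prefix-desubstitution []      []      = [] , [] , refl , z≤n
  prefix-desubstitution (x ∷ X) {v} v⊑ with prefix-of-block++ (exponent x) (subst (Prefix _≡_ v) (φ-∷ x X) v⊑)
  ... | inj₁ no-B = [] , [] , sym no-B , z≤n
  ... | inj₂ (v′ , refl , v′⊑) with prefix-desubstitution X v′⊑
  ... | y , y⊑X , length-y , length-φy =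
    x ∷ y , refl ∷ y⊑X , trans (cong suc length-y) (sym (countB-block++ (exponent x) v′)) , length-φ-x∷y
    where
    length-φ-x∷y : length (φ p q (x ∷ y)) ≤ length (block (exponent x) ++ v′)
    length-φ-x∷y = begin
      length (φ p q (x ∷ y))               ≡⟨ length-φ-∷ x y ⟩
      suc (exponent x + length (φ p q y))  ≤⟨ s≤s (+-monoʳ-≤ (exponent x) length-φy) ⟩
      suc (exponent x + length v′)         ≡⟨ length-block++ (exponent x) v′ ⟨
      length (block (exponent x) ++ v′)    ∎
      where open ≤-Reasoning

  -- v = A^j B · φ(ancestor) · A^k, where A^j B ends a block and A^k begins one.
  record Desubstitution (X v : List Letter) : Set where
    field
      ancestor          : List Letter
      ancestor-infix    : Infix _≡_ ancestor X
      countB≡           : countB v ≡ suc (length ancestor)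
      length-φ-ancestor : length (φ p q ancestor) < length v

    ancestor-shorter : length ancestor < length v
    ancestor-shorter = ≤-trans (≤-reflexive (sym countB≡)) (countB≤length v)

  infix-desubstitution : ∀ X {v} → Infix _≡_ v (φ p q X) → countB v ≡ 0 ⊎ Desubstitution X v
  infix-desubstitution []      (here [])   = inj₁ refl
  infix-desubstitution (x ∷ X) {v} v⊑ with infix-of-block++ (exponent x) (subst (Infix _≡_ v) (φ-∷ x X) v⊑)
  ... | inj₁ v⊑φX = map₂ extend (infix-desubstitution X v⊑φX)
    where
    extend : Desubstitution X v → Desubstitution (x ∷ X) v
    extend d = record { Desubstitution d; ancestor-infix = there (Desubstitution.ancestor-infix d) }
  ... | inj₂ (j , v⊑block) with prefix-of-block++ j v⊑block
  ... | inj₁ no-B = inj₁ no-B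
  ... | inj₂ (v′ , refl , v′⊑) with prefix-desubstitution X v′⊑
  ... | y , y⊑X , length-y , length-φy = inj₂ record
    { ancestor          = y
    ; ancestor-infix    = there (here y⊑X)
    ; countB≡           = trans (countB-block++ j v′) (cong suc (sym length-y))
    ; length-φ-ancestor = begin-strict
        length (φ p q y)       ≤⟨ length-φy ⟩
        length v′              ≤⟨ m≤n+m _ j ⟩
        j + length v′          <⟨ n<1+n _ ⟩
        suc (j + length v′)    ≡⟨ length-block++ j v′ ⟨
        length (block j ++ v′) ∎
    }
    where open ≤-Reasoning

-- |φ(y)| = (p + 1)|y| − (p − q)|y|_B, written with p = q + d so that no subtraction occurs.
length-φ : ∀ q d y → length (φ (q + d) q y) + d * countB y ≡ length y * suc (q + d)
length-φ q d []      = *-zeroʳ d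
length-φ q d (A ∷ y) = begin
  length (φ p q (A ∷ y)) + d * countB y        ≡⟨ cong (_+ d * countB y) (length-φ-∷ p q A y) ⟩
  suc (p + length (φ p q y)) + d * countB y    ≡⟨ cong suc (+-assoc p _ _) ⟩
  suc (p + (length (φ p q y) + d * countB y))  ≡⟨ cong (λ t → suc (p + t)) (length-φ q d y) ⟩
  suc p + length y * suc p                     ∎
  where
  open ≡-Reasoning
  p = q + d
length-φ q d (B ∷ y) = begin
  length (φ p q (B ∷ y)) + d * suc (countB y)     ≡⟨ cong (_+ d * suc (countB y)) (length-φ-∷ p q B y) ⟩
  suc (q + length (φ p q y)) + d * suc (countB y) ≡⟨ rearrange q d (length (φ p q y)) (countB y) ⟩
  suc p + (length (φ p q y) + d * countB y)       ≡⟨ cong (suc p +_) (length-φ q d y) ⟩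
  suc p + length y * suc p                        ∎
  where
  open ≡-Reasoning
  p = q + d
  open +-*-Solver
  rearrange : ∀ q d l c → suc (q + l) + d * suc c ≡ suc (q + d) + (l + d * c)
  rearrange = solve 4 (λ q d l c → con 1 :+ (q :+ l) :+ d :* (con 1 :+ c) := con 1 :+ (q :+ d) :+ (l :+ d :* c)) refl

length-φ-antitone : ∀ {p q} → q ≤ p → ∀ y y′ → length y ≡ length y′ → countB y ≤ countB y′ →
                    length (φ p q y′) ≤ length (φ p q y)
length-φ-antitone {p} {q} q≤p y y′ same-length fewer-B with m≤n⇒∃[o]m+o≡n q≤p
... | d , refl = +-cancelʳ-≤ (d * countB y) _ _ (begin
  length (φ p q y′) + d * countB y   ≤⟨ +-monoʳ-≤ (length (φ p q y′)) (*-monoʳ-≤ d fewer-B) ⟩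
  length (φ p q y′) + d * countB y′  ≡⟨ length-φ q d y′ ⟩
  length y′ * suc p                  ≡⟨ cong (_* suc p) same-length ⟨
  length y * suc p                   ≡⟨ length-φ q d y ⟨
  length (φ p q y) + d * countB y    ∎)
  where open ≤-Reasoning

module _ (p q : ℕ) where

  wFin-Prefix-mono : ∀ {m n} → m ≤ n → Prefix _≡_ (wFin p q m) (wFin p q n)
  wFin-Prefix-mono z≤n       = []
  wFin-Prefix-mono (s≤s m≤n) = refl ∷ φ-Prefix p q (wFin-Prefix-mono m≤n)

  n≤length-wFin : ∀ n → n ≤ length (wFin p q n)
  n≤length-wFin zero    = z≤n
  n≤length-wFin (suc n) = s≤s (≤-trans (n≤length-wFin n) (length≤length-φ p q (wFin p q n)))

  length-wPrefix : ∀ n → length (wPrefix p q n) ≡ n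
  length-wPrefix n = trans (length-take n (wFin p q n)) (m≤n⇒m⊓n≡m (n≤length-wFin n))

  countB≤countB-wPrefix : ∀ {x K n} → Prefix _≡_ x (wFin p q K) → length x ≤ n →
                          countB x ≤ countB (wPrefix p q n)
  countB≤countB-wPrefix {x} {K} {n} x⊑wK length-x = countB-Prefix-mono
    (Prefix-by-length (Prefix.trans trans x⊑wK (wFin-Prefix-mono (m≤m⊔n K n)))
                      (Prefix.trans trans (take-Prefix n (wFin p q n)) (wFin-Prefix-mono (m≤n⊔m K n)))
                      (≤-trans length-x (≤-reflexive (sym (length-wPrefix n)))))

  countB-wPrefix-mono : ∀ {m n} → m ≤ n → countB (wPrefix p q m) ≤ countB (wPrefix p q n)
  countB-wPrefix-mono {m} m≤n =
    countB≤countB-wPrefix (take-Prefix m (wFin p q m)) (≤-trans (≤-reflexive (length-wPrefix m)) m≤n)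

  FactorOfU : List Letter → Set
  FactorOfU v = ∃[ k ] Infix _≡_ v (φ^ p q k (A ∷ []))

  uFactor-factor : ∀ i n → FactorOfU (uFactor p q i n)
  uFactor-factor i n = i + n , drop-Infix i (take-Prefix (i + n) (φ^ p q (i + n) (A ∷ [])))

  factor-desubstitution : ∀ {v} → FactorOfU v →
                          countB v ≡ 0 ⊎ ∃[ k ] Desubstitution p q (φ^ p q k (A ∷ [])) v
  factor-desubstitution (zero  , v⊑A)  = inj₁ (n≤0⇒n≡0 (countB-Infix-mono v⊑A))
  factor-desubstitution (suc k , v⊑φX) = map₂ (k ,_) (infix-desubstitution p q _ v⊑φX)

  Dominated : List Letter → Set
  Dominated v = countB v ≤ countB (wPrefix p q (length v))

  module _ (q≤p : q ≤ p) where

    ancestor-dominated⇒dominated : ∀ {X v} (d : Desubstitution p q X v) →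
                                   Dominated (Desubstitution.ancestor d) → Dominated v
    ancestor-dominated⇒dominated {v = v} d ancestor-dominated = begin
      countB v                        ≡⟨ countB≡ ⟩
      suc (length y)                  ≡⟨ cong suc (length-wPrefix (length y)) ⟨
      suc (length z)                  ≡⟨ cong suc (countB-φ p q z) ⟨
      countB (B ∷ φ p q z)            ≤⟨ countB≤countB-wPrefix {K = suc (length y)} Bφz⊑w length-Bφz ⟩
      countB (wPrefix p q (length v)) ∎
      where
      open Desubstitution d renaming (ancestor to y)
      open ≤-Reasoning
      z = wPrefix p q (length y)
      Bφz⊑w : Prefix _≡_ (B ∷ φ p q z) (wFin p q (suc (length y)))
      Bφz⊑w = refl ∷ φ-Prefix p q (take-Prefix (length y) (wFin p q (length y)))
      length-Bφz : length (φ p q z) < length v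
      length-Bφz = ≤-<-trans (length-φ-antitone q≤p y z (sym (length-wPrefix (length y))) ancestor-dominated)
                             length-φ-ancestor

    factor-dominated : ∀ {v} → FactorOfU v → Dominated v
    factor-dominated v-factor = go v-factor (<-wellFounded _)
      where
      go : ∀ {v} → FactorOfU v → Acc _<_ (length v) → Dominated v
      go {v} v-factor (acc shorter) with factor-desubstitution v-factor
      ... | inj₁ no-B = subst (_≤ countB (wPrefix p q (length v))) (sym no-B) z≤n
      ... | inj₂ (k , d) = ancestor-dominated⇒dominated d
              (go (k , ancestor-infix) (shorter ancestor-shorter))
        where open Desubstitution d

mainTheorem8 : (p q : ℕ) → 1 ≤ q → q < p →
    ∀ (i n : ℕ) → countB (uFactor p q i n) ≤ countB (wPrefix p q n)
mainTheorem8 p q _ q<p i n = ≤-trans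
  (factor-dominated p q (<⇒≤ q<p) (uFactor-factor p q i n))
  (countB-wPrefix-mono p q (length-drop-take≤ i n (φ^ p q (i + n) (A ∷ []))))
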